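{- Let $A=(a_0,\dots,a_{n-1})$ be an integer array with $|a_m-a_{m+1}|=1$ for all $0\le m<n-1$. Let $0\le k\le i<n$ and let $x$ be an integer with $i-a_i+x<k$. Then $\mathrm{FS}_A(k,x)=\mathrm{FS}_A(i,x)$.
   Context: The query $\mathrm{FS}_A(i,x)$ returns the minimal index $j>i$ such that $a_j\le x$, and returns $0$ if no such $j$ exists. -}

module Defs where

open import Data.Nat using (ℕ; zero; suc; _∸_; _<?_)
open import Data.Fin using (Fin; fromℕ<)
open import Data.Integer using (ℤ; _≤?_)
open import Relation.Nullary using (yes; no)

-- FS a i x : the minimal index j > i (j < n) with a_j ≤ x, and 0 if none exists.
-- The array A = (a_0,…,a_{n-1}) is a function Fin n → ℤ.
FS : ∀ {n} → (Fin n → ℤ) → ℕ → ℤ → ℕ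
FS {n} a i x = go (suc i) (n ∸ suc i)
  where
  go : ℕ → ℕ → ℕ
  go j zero = 0
  go j (suc f) with j <? n
  ... | no _ = 0
  ... | yes j<n with a (fromℕ< j<n) ≤? x
  ...   | yes _ = j
  ...   | no _ = go (suc j) f

-- Since neighbouring entries differ by 1, a_j ≥ a_i − (i − j) for j ≤ i; so for k < j ≤ i the
-- hypothesis i − a_i + x < k gives a_j > x + (j − k) > x. No index of (k, i] can be the answer,
-- and FS is unchanged when the starting index moves from k to i one step at a time.
module Submission where

open import Defs
open import Data.Nat using (ℕ; suc) renaming (_≤_ to _≤ℕ_)
open import Data.Fin using (Fin; toℕ)
open import Data.Integer using (ℤ; +_; _+_; _-_; _<_; ∣_∣)
open import Relation.Binary.PropositionalEquality using (_≡_)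

open import Data.Nat as ℕ using (zero; _∸_; _<?_)
import Data.Nat.Properties as ℕ
open import Data.Fin using (fromℕ<)
open import Data.Fin.Properties using (toℕ<n; toℕ-fromℕ<; toℕ-injective)
open import Data.Integer using (-[1+_]; -_; _≤_; _≤?_; +≤+; -≤+)
import Data.Integer.Properties as ℤ
open import Data.Integer.Tactic.RingSolver using (solve; solve-∀)
open import Data.Empty using (⊥-elim)
open import Relation.Binary.PropositionalEquality using (refl; sym; trans; cong; subst)
open import Relation.Nullary using (yes; no)
open import Data.List using ([]; _∷_)

∣i∣≡1⇒-1≤i : ∀ i → ∣ i ∣ ≡ 1 → -[1+ 0 ] ≤ i
∣i∣≡1⇒-1≤i (+ _)          _ = -≤+
∣i∣≡1⇒-1≤i -[1+ zero ]    _ = ℤ.≤-refl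
∣i∣≡1⇒-1≤i -[1+ suc _ ] ()

∣i-j∣≡1⇒j≤i+1 : ∀ i j → ∣ i - j ∣ ≡ 1 → j ≤ i + + 1
∣i-j∣≡1⇒j≤i+1 i j h = begin
  j                       ≡⟨ solve (j ∷ []) ⟩
  -[1+ 0 ] + (j + + 1)    ≤⟨ ℤ.+-monoˡ-≤ (j + + 1) (∣i∣≡1⇒-1≤i (i - j) h) ⟩
  (i - j) + (j + + 1)     ≡⟨ solve (i ∷ j ∷ []) ⟩
  i + + 1                 ∎
  where open ℤ.≤-Reasoning

module _ {n : ℕ} (a : Fin n → ℤ) where

  RisesAtMostOne : Set
  RisesAtMostOne = ∀ (m m′ : Fin n) → toℕ m′ ≡ suc (toℕ m) → a m′ ≤ a m + + 1

  rise≤distance : RisesAtMostOne →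
                  ∀ d (m m′ : Fin n) → toℕ m′ ≡ d ℕ.+ toℕ m → a m′ ≤ a m + + d
  rise≤distance step zero m m′ m′≡m
    rewrite toℕ-injective m′≡m = ℤ.≤-reflexive (sym (ℤ.+-identityʳ (a m)))
  rise≤distance step (suc d) m m′ m′≡1+d+m = begin
    a m′              ≤⟨ step m″ m′ (trans m′≡1+d+m (cong suc (sym (toℕ-fromℕ< m″<n)))) ⟩
    a m″ + + 1        ≤⟨ ℤ.+-monoˡ-≤ (+ 1) (rise≤distance step d m m″ (toℕ-fromℕ< m″<n)) ⟩
    a m + + d + + 1   ≡⟨ ℤ.+-assoc (a m) (+ d) (+ 1) ⟩
    a m + + (d ℕ.+ 1) ≡⟨ cong (λ e → a m + + e) (ℕ.+-comm d 1) ⟩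
    a m + + suc d     ∎
    where
    open ℤ.≤-Reasoning
    m″<n : d ℕ.+ toℕ m ℕ.< n
    m″<n = ℕ.<⇒≤ (subst (ℕ._< n) m′≡1+d+m (toℕ<n m′))
    m″ : Fin n
    m″ = fromℕ< m″<n

  x<a-between : RisesAtMostOne →
                ∀ k x (i j : Fin n) → (+ toℕ i) - a i + x < + k →
                k ≤ℕ toℕ j → toℕ j ≤ℕ toℕ i → x < a j
  x<a-between step k x i j h k≤j j≤i = begin-strict
    x                                   ≡⟨ split (a i) I x ⟩
    (I - a i + x) + (a i - I)           <⟨ ℤ.+-monoˡ-< (a i - I) h ⟩
    + k + (a i - I)                     ≤⟨ ℤ.+-monoˡ-≤ (a i - I) (+≤+ k≤j) ⟩
    J + (a i - I)                       ≤⟨ ℤ.+-monoʳ-≤ J (ℤ.+-monoˡ-≤ (- I) ai≤aj+d) ⟩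
    J + (a j + D - I)                   ≡⟨ cong (λ e → J + (a j + D - e)) I≡D+J ⟩
    J + (a j + D - (D + J))             ≡⟨ cancel J (a j) D ⟩
    a j                                 ∎
    where
    open ℤ.≤-Reasoning
    I J D : ℤ
    I = + toℕ i
    J = + toℕ j
    D = + (toℕ i ∸ toℕ j)
    i≡d+j : toℕ i ≡ (toℕ i ∸ toℕ j) ℕ.+ toℕ j
    i≡d+j = sym (ℕ.m∸n+n≡m j≤i)
    I≡D+J : I ≡ D + J
    I≡D+J = trans (cong +_ i≡d+j) (ℤ.pos-+ (toℕ i ∸ toℕ j) (toℕ j))
    ai≤aj+d : a i ≤ a j + D
    ai≤aj+d = rise≤distance step (toℕ i ∸ toℕ j) j i i≡d+j
    split : ∀ A I x → x ≡ (I - A + x) + (A - I)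
    split = solve-∀
    cancel : ∀ J A D → J + (A + D - (D + J)) ≡ A
    cancel = solve-∀

  FS-skip : ∀ k x (j : Fin n) → toℕ j ≡ suc k → x < a j → FS a k x ≡ FS a (suc k) x
  -- Abstracting n ∸ suc k as a successor lets the scan inside FS take its first step.
  FS-skip k x j j≡1+k x<aj with n ∸ suc k | ℕ.+-∸-assoc 1 (1+k<n)
    where
    1+k<n : suc k ℕ.< n
    1+k<n = subst (ℕ._< n) j≡1+k (toℕ<n j)
  ... | _ | refl with suc k <? n
  ...   | no  1+k≮n = ⊥-elim (1+k≮n (subst (ℕ._< n) j≡1+k (toℕ<n j)))
  ...   | yes 1+k<n with a (fromℕ< 1+k<n) ≤? x
  ...     | no  _ = refl
  ...     | yes aj≤x = ⊥-elim (ℤ.<⇒≱ x<aj (subst (λ j → a j ≤ x) j′≡j aj≤x))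
    where
    j′≡j : fromℕ< 1+k<n ≡ j
    j′≡j = toℕ-injective (trans (toℕ-fromℕ< 1+k<n) (sym j≡1+k))

  FS-stable : ∀ k x d → d ℕ.+ k ℕ.< n →
              (∀ (j : Fin n) → k ℕ.< toℕ j → toℕ j ≤ℕ d ℕ.+ k → x < a j) →
              FS a k x ≡ FS a (d ℕ.+ k) x
  FS-stable k x zero _ _ = refl
  FS-stable k x (suc d) 1+d+k<n above = trans
    (FS-stable k x d (ℕ.<-trans (ℕ.n<1+n _) 1+d+k<n)
       (λ j k<j j≤d+k → above j k<j (ℕ.m≤n⇒m≤1+n j≤d+k)))
    (FS-skip (d ℕ.+ k) x j toℕj≡1+d+k
       (above j (subst (k ℕ.<_) (sym toℕj≡1+d+k) (ℕ.s≤s (ℕ.m≤n+m k d)))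
                (ℕ.≤-reflexive toℕj≡1+d+k)))
    where
    j : Fin n
    j = fromℕ< 1+d+k<n
    toℕj≡1+d+k : toℕ j ≡ suc (d ℕ.+ k)
    toℕj≡1+d+k = toℕ-fromℕ< 1+d+k<n

  FS-constant-until : ∀ k x (l : Fin n) → k ≤ℕ toℕ l →
                      (∀ (j : Fin n) → k ℕ.< toℕ j → toℕ j ≤ℕ toℕ l → x < a j) →
                      FS a k x ≡ FS a (toℕ l) x
  FS-constant-until k x l k≤l above = subst (λ l′ → FS a k x ≡ FS a l′ x) d+k≡l
    (FS-stable k x d (subst (ℕ._< n) (sym d+k≡l) (toℕ<n l))
       (λ j k<j j≤d+k → above j k<j (subst (toℕ j ≤ℕ_) d+k≡l j≤d+k)))
    where
    d : ℕ
    d = toℕ l ∸ k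
    d+k≡l : d ℕ.+ k ≡ toℕ l
    d+k≡l = ℕ.m∸n+n≡m k≤l

claim2 : (n : ℕ) (a : Fin n → ℤ) →
         (∀ (m m′ : Fin n) → toℕ m′ ≡ suc (toℕ m) → ∣ a m - a m′ ∣ ≡ 1) →
         (k : ℕ) (i : Fin n) (x : ℤ) →
         k ≤ℕ toℕ i →
         (+ toℕ i) - a i + x < + k →
         FS a k x ≡ FS a (toℕ i) x
claim2 n a unit-steps k i x k≤i h =
  FS-constant-until a k x i k≤i (λ j k<j j≤i → x<a-between a step k x i j h (ℕ.<⇒≤ k<j) j≤i)
  where
  step : RisesAtMostOne a
  step m m′ m′≡1+m = ∣i-j∣≡1⇒j≤i+1 (a m) (a m′) (unit-steps m m′ m′≡1+m)
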